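{- Let $P=\{(n_0,\dots,n_6) \mid n_0=n_1=n_4,\ n_2=n_6,\ n_3+n_5=n_0+n_2,\ n_0=\min_i n_i\}$. A position $M=(n_0,\dots,n_6)$ of ${\rm ECN}(7_{\{1,2\}},4)$ is a $\mathcal{P}$-position if and only if $M\in_\circlearrowleft P$.
   Context: Extended circular nim ${\rm ECN}(m_S,k)$ (positive integers $k\le m$, $S$ a set of positive integers each at most $m/2$): there are $m$ piles $v_0,\dots,v_{m-1}$ arranged in a circle (indices mod $m$); a position is a tuple $(n_0,\dots,n_{m-1})$ of nonnegative integers, $n_i$ being the number of tokens on $v_i$. A move chooses $s\in S$, $i\in\{0,\dots,m-1\}$, $j\in\{0,\dots,k-1\}$ and removes an arbitrary nonnegative number of tokens from each pile $v_{(i+ts)\bmod m}$, $t=0,\dots,j$, removing at least one token in total (empty piles still count as piles). Normal play: the player unable to move loses. A $\mathcal{P}$-position is a position from which the previous player (the player who just moved) has a winning strategy. For a set $P$ of $m$-tuples and $M=(n_0,\dots,n_{m-1})$, $M\in_\circlearrowleft P$ means there exists $i<m$ such that $(n_i,n_{(i+1)\bmod m},\dots,n_{(i+m-1)\bmod m})\in P$ or $(n_i,n_{(i+m-1)\bmod m},\dots,n_{(i+1)\bmod m})\in P$. -}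

module Defs where

open import Data.Nat using (ℕ; zero; suc; _+_; _*_; _∸_; _≤_; _<_; NonZero)
open import Data.Nat.DivMod using (_mod_)
open import Data.Fin using (Fin; toℕ; #_)
open import Data.List using (List; _∷_; [])
open import Data.List.Membership.Propositional using (_∈_)
open import Data.Product using (Σ; ∃; _×_; _,_)
open import Data.Sum using (_⊎_)
open import Relation.Nullary using (¬_)
open import Relation.Binary.PropositionalEquality using (_≡_)

Position : ℕ → Set
Position m = Fin m → ℕ

Affected : (m : ℕ) .{{_ : NonZero m}} → (s : ℕ) → (i : Fin m) → (j : ℕ) → Fin m → Set
Affected m s i j x = Σ ℕ λ t → (t ≤ j) × (x ≡ ((toℕ i + t * s) mod m))

Move : (m : ℕ) .{{_ : NonZero m}} → (S : List ℕ) → (k : ℕ) → Position m → Position m → Set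
Move m S k M M' =
  Σ ℕ λ s → (s ∈ S) × Σ (Fin m) λ i → Σ ℕ λ j → (j < k) ×
    ((∀ x → M' x ≤ M x) ×
     ((∀ x → ¬ Affected m s i j x → M' x ≡ M x) ×
      (∃ λ x → M' x < M x)))

-- P-positions (previous player wins) and N-positions (next player wins),
-- defined inductively as the existence of a (finite) winning strategy
-- under normal play.
mutual
  data IsP (m : ℕ) .{{_ : NonZero m}} (S : List ℕ) (k : ℕ) (M : Position m) : Set where
    allMovesToN : (∀ M' → Move m S k M M' → IsN m S k M') → IsP m S k M

  data IsN (m : ℕ) .{{_ : NonZero m}} (S : List ℕ) (k : ℕ) (M : Position m) : Set where
    moveToP : (M' : Position m) → Move m S k M M' → IsP m S k M' → IsN m S k M

rotate : (m : ℕ) .{{_ : NonZero m}} → Fin m → Position m → Position m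
rotate m i M x = M ((toℕ i + toℕ x) mod m)

reflectAt : (m : ℕ) .{{_ : NonZero m}} → Fin m → Position m → Position m
reflectAt m i M x = M ((toℕ i + (m ∸ toℕ x)) mod m)

CircIn : (m : ℕ) .{{_ : NonZero m}} → (Position m → Set) → Position m → Set
CircIn m P M = Σ (Fin m) λ i → P (rotate m i M) ⊎ P (reflectAt m i M)

P7 : Position 7 → Set
P7 n =
  (n (# 0) ≡ n (# 1)) × (n (# 1) ≡ n (# 4)) × (n (# 2) ≡ n (# 6)) ×
  (n (# 3) + n (# 5) ≡ n (# 0) + n (# 2)) × (∀ i → n (# 0) ≤ n i)

S12 : List ℕ
S12 = 1 ∷ 2 ∷ []

{-# OPTIONS --safe #-}
module Submission where

-- Every move removes tokens, so the P-positions are exactly the kernel of the game: the set of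
-- positions that is independent (no move joins two of its positions) and absorbing (every other
-- position has a move into it). The positions M ∈↻ P form such a kernel.
--
-- Independence rests on a finite fact: no move touches all three piles of a triple {a, a+1, a+4},
-- the triple holding the minimum of a position in P. So a move between two positions of P keeps a
-- pile of the target's triple; hence the minimum does not drop and the source's triple stays at
-- the minimum. This forces the target to be in P with the source's triple too, and since the
-- triples {2, 3, 6} and {5, 6, 2} also keep a pile, the move cannot change anything.
--
-- For absorption, rotate a smallest pile to place 0 and subtract its size from every pile.
-- Comparing piles 5 and 2, and then 6 or 1, decides whether the empty pile should become place
-- 0, 1 or 4 of the target's triple; in each case an explicit move inside a single window reaches
-- a position of the shape (0, 0, q + r, q, 0, r, q + r).

open import Defs
open import Algebra.Properties.CommutativeSemigroup using (interchange)
open import Data.Nat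
  using (ℕ; zero; suc; _+_; _*_; _∸_; _≤_; _<_; _≤?_; z≤n; s≤s; s≤s⁻¹; NonZero)
open import Data.Nat.Properties
open import Data.Nat.DivMod using (_mod_; _%_; %-distribˡ-+; m%n%n≡m%n; [m+n]%n≡m%n; m<n⇒m%n≡m)
open import Data.Nat.Induction using (<-wellFounded)
open import Induction.WellFounded using (Acc; acc)
open import Data.Fin using (Fin; toℕ; #_)
open import Data.Fin.Properties using (toℕ-fromℕ<; toℕ-injective; toℕ<n; all?; ¬∀⟶∃¬)
  renaming (_≟_ to _≟ᶠ_)
open import Data.List using (List; _∷_; []; filter; allFin)
open import Data.List.Relation.Unary.All using (All; _∷_; [])
import Data.List.Relation.Unary.All as All
open import Data.List.Relation.Unary.Any using (here; there)
open import Data.List.Membership.Propositional using (_∈_)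
open import Data.List.Membership.Propositional.Properties using (∈-allFin; ∈-filter⁺)
open import Data.List.Extrema.Nat using (argmin; f[argmin]≤f[xs])
open import Data.Vec using (lookup) renaming (_∷_ to _∷ᵛ_; [] to []ᵛ)
open import Data.Product using (Σ; ∃; ∃₂; _×_; _,_; proj₁; proj₂)
open import Data.Sum using (_⊎_; inj₁; inj₂; [_,_]′)
open import Data.Empty using (⊥; ⊥-elim)
open import Function using (id; _∘_)
open import Function.Bundles using (_⇔_; mk⇔)
open import Relation.Nullary using (¬_; Dec; yes; no)
open import Relation.Nullary.Decidable using (map′; ¬?; _⊎-dec_; from-yes)
open import Relation.Binary.Definitions using (Tri; tri<; tri≈; tri>)
open import Relation.Binary.PropositionalEquality

+-tight : ∀ {a b c d} → a ≤ c → b ≤ d → a + b ≡ c + d → a ≡ c × b ≡ d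
+-tight {a} {b} {c} {d} a≤c b≤d eq = a≡c , +-cancelˡ-≡ a b d (trans eq (cong (_+ d) (sym a≡c)))
  where
  a≡c : a ≡ c
  a≡c = ≤-antisym a≤c (+-cancelʳ-≤ b c a (≤-trans (+-monoʳ-≤ c b≤d) (≤-reflexive (sym eq))))

≤-offsetˡ : ∀ {n p m} → n ≤ p → p ≤ m + n → ∃ λ d → d ≤ m × d + n ≡ p
≤-offsetˡ {n} {p} {m} n≤p p≤m+n =
  p ∸ n , m≤n+o⇒m∸n≤o p n (≤-trans p≤m+n (≤-reflexive (+-comm m n))) , m∸n+n≡m n≤p

≤-offsetʳ : ∀ {n p m} → n ≤ p → p ≤ n + m → ∃ λ d → d ≤ m × n + d ≡ p
≤-offsetʳ {n} {p} n≤p p≤n+m = p ∸ n , m≤n+o⇒m∸n≤o p n p≤n+m , m+[n∸m]≡n n≤p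

≤-split : ∀ {p a b} → p ≤ a + b → ∃₂ λ q r → q ≤ a × r ≤ b × q + r ≡ p
≤-split {p} {a} {b} p≤a+b with ≤-total p a
... | inj₁ p≤a = p , 0 , p≤a , z≤n , +-identityʳ p
... | inj₂ a≤p with ≤-offsetʳ a≤p p≤a+b
...   | d , d≤b , a+d≡p = a , d , ≤-refl , d≤b , a+d≡p

everywhere : ∀ {n} {P : Fin n → Set} → All P (allFin n) → ∀ x → P x
everywhere Ps x = All.lookup Ps (∈-allFin x)

minimum : ∀ {n} (f : Fin (suc n) → ℕ) → Σ (Fin (suc n)) λ z → ∀ x → f z ≤ f x
minimum f = argmin f Fin.zero (allFin _) ,
            everywhere (f[argmin]≤f[xs] {f = f} Fin.zero (allFin _))

-- Kernels of the game graph

total : ∀ {n} → (Fin n → ℕ) → ℕ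
total {zero}  f = 0
total {suc n} f = f Fin.zero + total (f ∘ Fin.suc)

total-mono-≤ : ∀ {n} {f g : Fin n → ℕ} → (∀ x → f x ≤ g x) → total f ≤ total g
total-mono-≤ {zero}  f≤g = z≤n
total-mono-≤ {suc n} f≤g = +-mono-≤ (f≤g Fin.zero) (total-mono-≤ (f≤g ∘ Fin.suc))

total-mono-< : ∀ {n} {f g : Fin n → ℕ} → (∀ x → f x ≤ g x) → ∃ (λ x → f x < g x) →
               total f < total g
total-mono-< f≤g (Fin.zero  , f<g) = +-mono-<-≤ f<g (total-mono-≤ (f≤g ∘ Fin.suc))
total-mono-< f≤g (Fin.suc x , f<g) =
  +-mono-≤-< (f≤g Fin.zero) (total-mono-< (f≤g ∘ Fin.suc) (x , f<g))

module _ {m : ℕ} .{{_ : NonZero m}} {S : List ℕ} {k : ℕ} where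

  move-decreases-total : ∀ {M M'} → Move m S k M M' → total M' < total M
  move-decreases-total (_ , _ , _ , _ , _ , M'≤M , _ , M'<M) = total-mono-< M'≤M M'<M

  IsP⇒¬IsN : ∀ {M} → IsP m S k M → ¬ IsN m S k M
  IsP⇒¬IsN (allMovesToN toN) (moveToP M' mv isP) = IsP⇒¬IsN isP (toN M' mv)

Absorbs : (m : ℕ) .{{_ : NonZero m}} → List ℕ → ℕ → (Position m → Set) → Position m → Set
Absorbs m S k Q M = Q M ⊎ ∃ λ M' → Move m S k M M' × Q M'

record Kernel (m : ℕ) .{{_ : NonZero m}} (S : List ℕ) (k : ℕ) (Q : Position m → Set) : Set where
  field
    independent : ∀ {M M'} → Q M → Move m S k M M' → ¬ Q M'
    absorbing   : ∀ M → Absorbs m S k Q M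

module _ {m : ℕ} .{{_ : NonZero m}} {S : List ℕ} {k : ℕ} {Q : Position m → Set}
         (K : Kernel m S k Q) where
  open Kernel K

  kernel⇒IsP : ∀ {M} → Q M → IsP m S k M
  kernel⇒IsP {M} = go M (<-wellFounded (total M))
    where
    go : ∀ N → Acc _<_ (total N) → Q N → IsP m S k N
    go N (acc rec) qN = allMovesToN λ M' mv →
      [ ⊥-elim ∘ independent qN mv ,
        (λ (M'' , mv' , qM'') → moveToP M'' mv'
           (go M'' (rec (<-trans (move-decreases-total mv') (move-decreases-total mv))) qM'')) ]′
      (absorbing M')

  IsP⇒kernel : ∀ {M} → IsP m S k M → Q M
  IsP⇒kernel {M} (allMovesToN toN) =
    [ id , (λ (M' , mv , qM') → ⊥-elim (IsP⇒¬IsN (kernel⇒IsP qM') (toN M' mv))) ]′ (absorbing M)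

  IsP⇔kernel : ∀ M → IsP m S k M ⇔ Q M
  IsP⇔kernel M = mk⇔ IsP⇒kernel kernel⇒IsP

-- Rotations of the circle

-- Definitionally, rotate m g M x is M (g ⊕ toℕ x) and Affected m s i j x says x ≡ i ⊕ t * s.
module _ {m : ℕ} .{{_ : NonZero m}} where

  infixl 6 _⊕_

  _⊕_ : Fin m → ℕ → Fin m
  i ⊕ n = (toℕ i + n) mod m

  _⁻ : Fin m → Fin m
  g ⁻ = (m ∸ toℕ g) mod m

  mod-cong : ∀ {a b} → a % m ≡ b % m → a mod m ≡ b mod m
  mod-cong eq = toℕ-injective (trans (toℕ-fromℕ< _) (trans eq (sym (toℕ-fromℕ< _))))

  toℕ-mod : ∀ x → toℕ x mod m ≡ x
  toℕ-mod x = toℕ-injective (trans (toℕ-fromℕ< _) (m<n⇒m%n≡m (toℕ<n x)))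

  [m%n+k]%n≡[m+k]%n : ∀ a b → (a % m + b) % m ≡ (a + b) % m
  [m%n+k]%n≡[m+k]%n a b = begin
    (a % m + b) % m         ≡⟨ %-distribˡ-+ (a % m) b m ⟩
    (a % m % m + b % m) % m ≡⟨ cong (λ z → (z + b % m) % m) (m%n%n≡m%n a m) ⟩
    (a % m + b % m) % m     ≡⟨ %-distribˡ-+ a b m ⟨
    (a + b) % m             ∎
    where open ≡-Reasoning

  ⊕-assoc : ∀ i a b → i ⊕ a ⊕ b ≡ i ⊕ (a + b)
  ⊕-assoc i a b = mod-cong (begin
    (toℕ (i ⊕ a) + b) % m    ≡⟨ cong (λ z → (z + b) % m) (toℕ-fromℕ< _) ⟩
    ((toℕ i + a) % m + b) % m ≡⟨ [m%n+k]%n≡[m+k]%n (toℕ i + a) b ⟩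
    (toℕ i + a + b) % m       ≡⟨ cong (_% m) (+-assoc (toℕ i) a b) ⟩
    (toℕ i + (a + b)) % m     ∎)
    where open ≡-Reasoning

  ⊕-toℕ : ∀ i j n → i ⊕ toℕ (j ⊕ n) ≡ i ⊕ (toℕ j + n)
  ⊕-toℕ i j n = mod-cong (begin
    (toℕ i + toℕ (j ⊕ n)) % m     ≡⟨ cong (λ z → (toℕ i + z) % m) (toℕ-fromℕ< _) ⟩
    (toℕ i + (toℕ j + n) % m) % m ≡⟨ cong (_% m) (+-comm (toℕ i) _) ⟩
    ((toℕ j + n) % m + toℕ i) % m ≡⟨ [m%n+k]%n≡[m+k]%n (toℕ j + n) (toℕ i) ⟩
    (toℕ j + n + toℕ i) % m       ≡⟨ cong (_% m) (+-comm _ (toℕ i)) ⟩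
    (toℕ i + (toℕ j + n)) % m     ∎)
    where open ≡-Reasoning

  ⊕-identityʳ : ∀ i → i ⊕ 0 ≡ i
  ⊕-identityʳ i = trans (cong (_mod m) (+-identityʳ (toℕ i))) (toℕ-mod i)

  ⊕-comm : ∀ a b → a ⊕ toℕ b ≡ b ⊕ toℕ a
  ⊕-comm a b = cong (_mod m) (+-comm (toℕ a) (toℕ b))

  ⊕-inverse : ∀ g a → g ⊕ toℕ (a ⊕ toℕ (g ⁻)) ≡ a
  ⊕-inverse g a = begin
    g ⊕ toℕ (a ⊕ toℕ (g ⁻))  ≡⟨ ⊕-toℕ g a _ ⟩
    g ⊕ (toℕ a + toℕ (g ⁻))  ≡⟨ mod-cong cancel ⟩
    toℕ a mod m              ≡⟨ toℕ-mod a ⟩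
    a                        ∎
    where
    open ≡-Reasoning
    G = toℕ g
    A = toℕ a
    cancel : (G + (A + toℕ (g ⁻))) % m ≡ A % m
    cancel = begin
      (G + (A + toℕ (g ⁻))) % m   ≡⟨ cong (λ z → (G + (A + z)) % m) (toℕ-fromℕ< _) ⟩
      (G + (A + (m ∸ G) % m)) % m ≡⟨ cong (_% m) (+-comm G _) ⟩
      (A + (m ∸ G) % m + G) % m   ≡⟨ cong (λ z → (z + G) % m) (+-comm A _) ⟩
      ((m ∸ G) % m + A + G) % m   ≡⟨ cong (_% m) (+-assoc _ A G) ⟩
      ((m ∸ G) % m + (A + G)) % m ≡⟨ cong (λ z → ((m ∸ G) % m + z) % m) (+-comm A G) ⟩
      ((m ∸ G) % m + (G + A)) % m ≡⟨ [m%n+k]%n≡[m+k]%n (m ∸ G) (G + A) ⟩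
      (m ∸ G + (G + A)) % m       ≡⟨ cong (_% m) (+-assoc (m ∸ G) G A) ⟨
      (m ∸ G + G + A) % m         ≡⟨ cong (λ z → (z + A) % m) (m∸n+n≡m (<⇒≤ (toℕ<n g))) ⟩
      (m + A) % m                 ≡⟨ cong (_% m) (+-comm m A) ⟩
      (A + m) % m                 ≡⟨ [m+n]%n≡m%n A m ⟩
      A % m                       ∎

  affected-rotate : ∀ {s i j g x} →
                    Affected m s i j (g ⊕ toℕ x) → Affected m s (i ⊕ toℕ (g ⁻)) j x
  affected-rotate {s} {i} {g = g} {x} (t , t≤j , eq) = t , t≤j , (begin
    x                         ≡⟨ ⊕-inverse g x ⟨
    g ⊕ toℕ (x ⊕ toℕ (g ⁻))   ≡⟨ ⊕-toℕ g x _ ⟩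
    g ⊕ (toℕ x + toℕ (g ⁻))   ≡⟨ ⊕-assoc g _ _ ⟨
    g ⊕ toℕ x ⊕ toℕ (g ⁻)     ≡⟨ cong (_⊕ toℕ (g ⁻)) eq ⟩
    i ⊕ t * s ⊕ toℕ (g ⁻)     ≡⟨ ⊕-assoc i _ _ ⟩
    i ⊕ (t * s + toℕ (g ⁻))   ≡⟨ cong (i ⊕_) (+-comm (t * s) _) ⟩
    i ⊕ (toℕ (g ⁻) + t * s)   ≡⟨ ⊕-assoc i _ _ ⟨
    i ⊕ toℕ (g ⁻) ⊕ t * s     ∎)
    where open ≡-Reasoning

  rotate-rotate : ∀ b g M → rotate m b (rotate m g M) ≗ rotate m (g ⊕ toℕ b) M
  rotate-rotate b g M x = cong M (trans (⊕-toℕ g b (toℕ x)) (sym (⊕-assoc g (toℕ b) (toℕ x))))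

  rotate-inverse : ∀ g M → rotate m (g ⁻) (rotate m g M) ≗ M
  rotate-inverse g M x = cong M (trans (cong (λ y → g ⊕ toℕ y) (⊕-comm (g ⁻) x)) (⊕-inverse g x))

module _ {m : ℕ} .{{_ : NonZero m}} {S : List ℕ} {k : ℕ} where

  move-rotate : ∀ g {M M'} → Move m S k M M' → Move m S k (rotate m g M) (rotate m g M')
  move-rotate g {M} {M'} (s , s∈S , i , j , j<k , M'≤M , untouched , y , M'y<My) =
    s , s∈S , i ⊕ toℕ (g ⁻) , j , j<k , (λ x → M'≤M (g ⊕ toℕ x)) ,
    (λ x na → untouched (g ⊕ toℕ x) (na ∘ affected-rotate)) ,
    y ⊕ toℕ (g ⁻) , subst (λ z → M' z < M z) (sym (⊕-inverse g y)) M'y<My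

  move-resp : ∀ {M M' N N'} → M ≗ N → M' ≗ N' → Move m S k M M' → Move m S k N N'
  move-resp M≗N M'≗N' (s , s∈S , i , j , j<k , M'≤M , untouched , y , M'y<My) =
    s , s∈S , i , j , j<k , (λ x → subst₂ _≤_ (M'≗N' x) (M≗N x) (M'≤M x)) ,
    (λ x na → trans (sym (M'≗N' x)) (trans (untouched x na) (M≗N x))) ,
    y , subst₂ _<_ (M'≗N' y) (M≗N y) M'y<My

  move-translate : ∀ c {M M'} → Move m S k M M' → Move m S k (λ x → c + M x) (λ x → c + M' x)
  move-translate c (s , s∈S , i , j , j<k , M'≤M , untouched , y , M'y<My) =
    s , s∈S , i , j , j<k , +-monoʳ-≤ c ∘ M'≤M , (λ x na → cong (c +_) (untouched x na)) ,
    y , +-monoʳ-< c M'y<My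

RotIn : (m : ℕ) .{{_ : NonZero m}} → (Position m → Set) → Position m → Set
RotIn m P M = Σ (Fin m) λ a → P (rotate m a M)

module _ {m : ℕ} .{{_ : NonZero m}} {P : Position m → Set}
         (P-resp : ∀ {M N} → M ≗ N → P M → P N) where

  RotIn-resp : ∀ {M N} → M ≗ N → RotIn m P M → RotIn m P N
  RotIn-resp M≗N (a , p) = a , P-resp (λ x → M≗N (a ⊕ toℕ x)) p

  RotIn-rotate : ∀ g {M} → RotIn m P M → RotIn m P (rotate m g M)
  RotIn-rotate g {M} (a , p) = a ⊕ toℕ (g ⁻) , P-resp (λ x → sym (trans (rotate-rotate _ g M x)
    (cong (λ b → rotate m b M x) (⊕-inverse g a)))) p

module _ {m : ℕ} .{{_ : NonZero m}} {S : List ℕ} {k : ℕ} {P : Position m → Set}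
         (P-resp : ∀ {M N} → M ≗ N → P M → P N) where

  absorbs-resp : ∀ {M N} → M ≗ N → Absorbs m S k (RotIn m P) M → Absorbs m S k (RotIn m P) N
  absorbs-resp M≗N (inj₁ inP) = inj₁ (RotIn-resp P-resp M≗N inP)
  absorbs-resp M≗N (inj₂ (M' , mv , inP)) = inj₂ (M' , move-resp M≗N (λ _ → refl) mv , inP)

  absorbs-unrotate : ∀ g {N} → Absorbs m S k (RotIn m P) (rotate m g N) → Absorbs m S k (RotIn m P) N
  absorbs-unrotate g {N} (inj₁ inP) =
    inj₁ (RotIn-resp P-resp (rotate-inverse g N) (RotIn-rotate P-resp (g ⁻) {rotate m g N} inP))
  absorbs-unrotate g {N} (inj₂ (M' , mv , inP)) =
    inj₂ (rotate m (g ⁻) M' , move-resp (rotate-inverse g N) (λ _ → refl) (move-rotate (g ⁻) mv) ,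
          RotIn-rotate P-resp (g ⁻) {M'} inP)

  absorbs-translate : (∀ c {M} → P M → P (λ x → c + M x)) → ∀ c {E} →
                      Absorbs m S k (RotIn m P) E → Absorbs m S k (RotIn m P) (λ x → c + E x)
  absorbs-translate P-translate c (inj₁ (a , p)) = inj₁ (a , P-translate c p)
  absorbs-translate P-translate c (inj₂ (E' , mv , (a , p))) =
    inj₂ ((λ x → c + E' x) , move-translate c mv , (a , P-translate c p))

affected? : ∀ m .{{_ : NonZero m}} s i j x → Dec (Affected m s i j x)
affected? m s i j x = map′ (λ (t , t<1+j , eq) → t , s≤s⁻¹ t<1+j , eq)
                           (λ (t , t≤j , eq) → t , s≤s t≤j , eq)
                           (anyUpTo? (λ t → x ≟ᶠ i ⊕ t * s) (suc j))

-- ECN(7_{1,2}, 4) and the set P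

infix 4 _↝_

_↝_ : Position 7 → Position 7 → Set
M ↝ M' = Move 7 S12 4 M M'

InP : Position 7 → Set
InP = RotIn 7 P7

EntersP : Position 7 → Set
EntersP = Absorbs 7 S12 4 InP

-- j = 3 is the longest move allowed by k = 4: it touches every pile a move (s, i, j) can touch.
Untouched : ℕ → Fin 7 → Fin 7 → Set
Untouched s i x = ¬ Affected 7 s i 3 x

P7-resp : ∀ {M N} → M ≗ N → P7 M → P7 N
P7-resp {M} {N} M≗N (e01 , e14 , e26 , sum , least) =
  transport e01 , transport e14 , transport e26 ,
  trans (sym (cong₂ _+_ (M≗N _) (M≗N _))) (trans sum (cong₂ _+_ (M≗N _) (M≗N _))) ,
  (λ x → subst₂ _≤_ (M≗N _) (M≗N x) (least x))
  where
  transport : ∀ {x y} → M x ≡ M y → N x ≡ N y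
  transport {x} {y} e = trans (sym (M≗N x)) (trans e (M≗N y))

P7-translate : ∀ c {M} → P7 M → P7 (λ x → c + M x)
P7-translate c (e01 , e14 , e26 , sum , least) =
  cong (c +_) e01 , cong (c +_) e14 , cong (c +_) e26 ,
  trans (swap c _ c _) (trans (cong (c + c +_) sum) (sym (swap c _ c _))) ,
  (λ x → +-monoʳ-≤ c (least x))
  where swap = interchange +-commutativeSemigroup

P7⇒InP : ∀ {M} → P7 M → InP M
P7⇒InP {M} p = # 0 , P7-resp (λ x → cong M (sym (toℕ-mod x))) p

-- reflectAt 7 (# 1) is the mirror x ↦ 1 - x: it swaps 0 ↔ 1, 2 ↔ 6, 3 ↔ 5 and fixes 4.
P7-mirror : ∀ {M} → P7 M → P7 (reflectAt 7 (# 1) M)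
P7-mirror {M} (e01 , e14 , e26 , sum , least) =
  sym e01 , trans e01 e14 , sym e26 ,
  trans (+-comm (M (# 5)) (M (# 3))) (trans sum (cong₂ _+_ e01 e26)) ,
  (λ x → subst (_≤ M ((1 + (7 ∸ toℕ x)) mod 7)) e01 (least ((1 + (7 ∸ toℕ x)) mod 7)))

reflect-reflect : ∀ i M → reflectAt 7 (# 1) (reflectAt 7 i M) ≗ rotate 7 (i ⊕ 6) M
reflect-reflect i M x = cong M (indices i x)
  where
  indices : ∀ i x → (toℕ i + (7 ∸ toℕ ((1 + (7 ∸ toℕ x)) mod 7))) mod 7 ≡ i ⊕ 6 ⊕ toℕ x
  indices = from-yes (all? λ (i : Fin 7) → all? λ (x : Fin 7) →
    (toℕ i + (7 ∸ toℕ ((1 + (7 ∸ toℕ x)) mod 7))) mod 7 ≟ᶠ i ⊕ 6 ⊕ toℕ x)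

CircIn⇒InP : ∀ {M} → CircIn 7 P7 M → InP M
CircIn⇒InP     (i , inj₁ p) = i , p
CircIn⇒InP {M} (i , inj₂ p) = i ⊕ 6 , P7-resp (reflect-reflect i M) (P7-mirror p)

InP⇒CircIn : ∀ {M} → InP M → CircIn 7 P7 M
InP⇒CircIn (a , p) = a , inj₁ p

P7-lowest : ∀ a {M} → P7 (rotate 7 a M) → ∀ y → M (a ⊕ 0) ≤ M y
P7-lowest a {M} (_ , _ , _ , _ , least) y =
  subst (λ z → M (a ⊕ 0) ≤ M z) (⊕-inverse a y) (least (y ⊕ toℕ (a ⁻)))

P7-flat : ∀ a {M} → P7 (rotate 7 a M) → M (a ⊕ 2) ≡ M (a ⊕ 0) → ∀ y → M y ≡ M (a ⊕ 0)
P7-flat a {M} p@(e01 , e14 , e26 , sum , _) e20 y =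
  subst (λ z → M z ≡ M (a ⊕ 0)) (⊕-inverse a y) (flat (y ⊕ toℕ (a ⁻)))
  where
  e35 : M (a ⊕ 0) ≡ M (a ⊕ 3) × M (a ⊕ 0) ≡ M (a ⊕ 5)
  e35 = +-tight (P7-lowest a {M} p (a ⊕ 3)) (P7-lowest a {M} p (a ⊕ 5))
                (trans (cong (M (a ⊕ 0) +_) (sym e20)) (sym sum))

  flat : ∀ x → M (a ⊕ toℕ x) ≡ M (a ⊕ 0)
  flat = everywhere (refl ∷ sym e01 ∷ e20 ∷ sym (proj₁ e35) ∷ sym (trans e01 e14) ∷
                     sym (proj₂ e35) ∷ trans (sym e26) e20 ∷ [])

P7-pairs : Position 7 → Set
P7-pairs M = M (# 2) ≡ M (# 6) × M (# 3) + M (# 5) ≡ M (# 0) + M (# 2)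

constant⇒P7-pairs : ∀ {M : Position 7} {c} → (∀ y → M y ≡ c) → P7-pairs M
constant⇒P7-pairs {M} flat = trans (flat (# 2)) (sym (flat (# 6))) ,
  cong₂ _+_ (trans (flat (# 3)) (sym (flat (# 0)))) (trans (flat (# 5)) (sym (flat (# 2))))

-- For a ∈ {1, 2, 5, 6} the pair {a+2, a+6} meets {0, 1, 4}, which flattens the position.
rotated-P7-pairs : ∀ a {M} → P7 (rotate 7 a M) →
                   M (# 0) ≡ M (a ⊕ 0) → M (# 1) ≡ M (a ⊕ 0) → M (# 4) ≡ M (a ⊕ 0) →
                   P7-pairs M
rotated-P7-pairs Fin.zero (_ , _ , e26 , sum , _) _ _ _ = e26 , sum
rotated-P7-pairs (Fin.suc Fin.zero) {M} p@(_ , _ , e30 , _ , _) h0 _ _ =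
  constant⇒P7-pairs (P7-flat (# 1) {M} p (trans e30 h0))
rotated-P7-pairs (Fin.suc (Fin.suc Fin.zero)) {M} p _ _ h4 =
  constant⇒P7-pairs (P7-flat (# 2) {M} p h4)
rotated-P7-pairs (Fin.suc (Fin.suc (Fin.suc Fin.zero))) {M} (_ , _ , e52 , sum , _) h0 h1 _ =
  trans (sym e52) (sym (+-cancelʳ-≡ (M (# 3)) (M (# 6)) (M (# 5))
    (trans (cong (M (# 6) +_) (sym h1)) (trans sum (+-comm (M (# 3)) (M (# 5))))))) ,
  cong₂ _+_ (sym h0) e52
rotated-P7-pairs (Fin.suc (Fin.suc (Fin.suc (Fin.suc Fin.zero)))) {M} (e45 , _ , e63 , sum , _) h0 _ _ =
  +-cancelˡ-≡ (M (# 4)) (M (# 2)) (M (# 6)) (trans (cong (_+ M (# 2)) (sym h0)) sum) ,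
  trans (cong₂ _+_ (sym e63) (sym e45)) (trans (+-comm (M (# 6)) (M (# 4))) (sym sum))
rotated-P7-pairs (Fin.suc (Fin.suc (Fin.suc (Fin.suc (Fin.suc Fin.zero))))) {M} p h0 _ _ =
  constant⇒P7-pairs (P7-flat (# 5) {M} p h0)
rotated-P7-pairs (Fin.suc (Fin.suc (Fin.suc (Fin.suc (Fin.suc (Fin.suc Fin.zero)))))) {M} p _ h1 _ =
  constant⇒P7-pairs (P7-flat (# 6) {M} p h1)

P7-rigid : ∀ a {M} → P7 (rotate 7 a M) →
           M (# 0) ≡ M (a ⊕ 0) → M (# 1) ≡ M (a ⊕ 0) → M (# 4) ≡ M (a ⊕ 0) → P7 M
P7-rigid a {M} p h0 h1 h4 =
  trans h0 (sym h1) , trans h1 (sym h4) , proj₁ pairs , proj₂ pairs ,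
  (λ y → subst (_≤ M y) (sym h0) (P7-lowest a {M} p y))
  where
  pairs = rotated-P7-pairs a {M} p h0 h1 h4

P7-agree : ∀ {M N} → P7 M → P7 N → N (# 3) ≤ M (# 3) → N (# 5) ≤ M (# 5) →
           N (# 0) ≡ M (# 0) →
           N (# 2) ≡ M (# 2) ⊎ N (# 6) ≡ M (# 6) ⊎ N (# 3) ≡ M (# 3) × N (# 5) ≡ M (# 5) →
           N ≗ M
P7-agree {M} {N} (m01 , m14 , m26 , msum , _) (n01 , n14 , n26 , nsum , _) 3≤ 5≤ e0 =
  [ agree-from-2 , [ agree-from-2 ∘ via-6 , agree-from-2 ∘ via-3-5 ]′ ]′
  where
  agree-from-2 : N (# 2) ≡ M (# 2) → N ≗ M
  agree-from-2 e2 = everywhere (e0 ∷ e1 ∷ e2 ∷ proj₁ e35 ∷ trans (sym n14) (trans e1 m14) ∷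
                                proj₂ e35 ∷ trans (sym n26) (trans e2 m26) ∷ [])
    where
    e1 = trans (sym n01) (trans e0 m01)
    e35 = +-tight 3≤ 5≤ (trans nsum (trans (cong₂ _+_ e0 e2) (sym msum)))

  via-6 : N (# 6) ≡ M (# 6) → N (# 2) ≡ M (# 2)
  via-6 e6 = trans n26 (trans e6 (sym m26))

  via-3-5 : N (# 3) ≡ M (# 3) × N (# 5) ≡ M (# 5) → N (# 2) ≡ M (# 2)
  via-3-5 (e3 , e5) = +-cancelˡ-≡ (M (# 0)) (N (# 2)) (M (# 2))
    (trans (cong (_+ N (# 2)) (sym e0)) (trans (sym nsum) (trans (cong₂ _+_ e3 e5) msum)))

-- Independence

TripleEscapes : ℕ → Set
TripleEscapes s = ∀ i a → Untouched s i (a ⊕ 0) ⊎ Untouched s i (a ⊕ 1) ⊎ Untouched s i (a ⊕ 4)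

triple-escapes? : ∀ s → Dec (TripleEscapes s)
triple-escapes? s = all? λ i → all? λ a →
  spare i (a ⊕ 0) ⊎-dec spare i (a ⊕ 1) ⊎-dec spare i (a ⊕ 4)
  where spare = λ i x → ¬? (affected? 7 s i 3 x)

triple-escapes-window : ∀ {s} → s ∈ S12 → TripleEscapes s
triple-escapes-window (here refl)         = from-yes (triple-escapes? 1)
triple-escapes-window (there (here refl)) = from-yes (triple-escapes? 2)

no-move-between-P7 : ∀ {M M' a} → P7 M → M ↝ M' → P7 (rotate 7 a M') → ⊥
no-move-between-P7 {M} {M'} {a} pM@(M0≡M1 , M1≡M4 , _ , _ , M0-least)
                   (s , s∈S , i , j , j<4 , M'≤M , untouched , y , M'y<My) pM'@(r01 , r14 , _) =
  <-irrefl (M'≗M y) M'y<My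
  where
  fixed : ∀ {x} → Untouched s i x → M' x ≡ M x
  fixed u = untouched _ (λ (t , t≤j , eq) → u (t , ≤-trans t≤j (s≤s⁻¹ j<4) , eq))

  base-via : ∀ {t} → Untouched s i t → M' t ≡ M' (a ⊕ 0) → M (# 0) ≤ M' (a ⊕ 0)
  base-via {t} u e = subst (M (# 0) ≤_) (trans (sym (fixed u)) e) (M0-least t)

  base≤level : M (# 0) ≤ M' (a ⊕ 0)
  base≤level = [ (λ u → base-via u refl) , [ (λ u → base-via u (sym r01)) ,
                 (λ u → base-via u (sym (trans r01 r14))) ]′ ]′ (triple-escapes-window s∈S i a)

  level≡base : M' (a ⊕ 0) ≡ M (# 0)
  level≡base = ≤-antisym (≤-trans (P7-lowest a {M'} pM' (# 0)) (M'≤M (# 0))) base≤level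

  at-base : ∀ x → M x ≡ M (# 0) → M' x ≡ M x
  at-base x e =
    ≤-antisym (M'≤M x) (subst (_≤ M' x) (trans level≡base (sym e)) (P7-lowest a {M'} pM' x))

  at-level : ∀ x → M x ≡ M (# 0) → M' x ≡ M' (a ⊕ 0)
  at-level x e = trans (at-base x e) (trans e (sym level≡base))

  pM'₀ : P7 M'
  pM'₀ = P7-rigid a {M'} pM' (at-level (# 0) refl) (at-level (# 1) (sym M0≡M1))
                             (at-level (# 4) (sym (trans M0≡M1 M1≡M4)))

  -- The triples of a = 2 and a = 5 are {2, 3, 6} and {5, 6, 2}.
  outer-fixed : M' (# 2) ≡ M (# 2) ⊎ M' (# 6) ≡ M (# 6) ⊎ M' (# 3) ≡ M (# 3) × M' (# 5) ≡ M (# 5)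
  outer-fixed with triple-escapes-window s∈S i (# 2) | triple-escapes-window s∈S i (# 5)
  ... | inj₁ u2        | _              = inj₁ (fixed u2)
  ... | inj₂ (inj₂ u6) | _              = inj₂ (inj₁ (fixed u6))
  ... | _              | inj₂ (inj₁ u6) = inj₂ (inj₁ (fixed u6))
  ... | _              | inj₂ (inj₂ u2) = inj₁ (fixed u2)
  ... | inj₂ (inj₁ u3) | inj₁ u5        = inj₂ (inj₂ (fixed u3 , fixed u5))

  M'≗M : M' ≗ M
  M'≗M = P7-agree {M} {M'} pM pM'₀ (M'≤M (# 3)) (M'≤M (# 5)) (at-base (# 0) refl) outer-fixed

P-independent : ∀ {M M'} → InP M → M ↝ M' → ¬ InP M'
P-independent {M} {M'} (g , pM) mv inP' with RotIn-rotate P7-resp g {M'} inP'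
... | a , pM' = no-move-between-P7 {rotate 7 g M} {rotate 7 g M'} {a} pM (move-rotate g mv) pM'

-- Absorption

shape : ℕ → ℕ → Position 7
shape q r = lookup (0 ∷ᵛ 0 ∷ᵛ q + r ∷ᵛ q ∷ᵛ 0 ∷ᵛ r ∷ᵛ q + r ∷ᵛ []ᵛ)

P7-shape : ∀ q r → P7 (shape q r)
P7-shape q r = refl , refl , refl , refl , λ _ → z≤n

window spared : ℕ → Fin 7 → List (Fin 7)
window s i = filter (affected? 7 s i 3) (allFin 7)
spared s i = filter (¬? ∘ affected? 7 s i 3) (allFin 7)

enter-shape : ∀ {E s} q r → s ∈ S12 → ∀ i →
              All (λ x → shape q r x ≤ E x) (window s i) →
              All (λ x → shape q r x ≡ E x) (spared s i) → EntersP E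
enter-shape {E} {s} q r s∈S i below same with all? (λ x → shape q r x ≟ E x)
... | yes shape≗E = inj₁ (P7⇒InP (P7-resp shape≗E (P7-shape q r)))
... | no shape≉E  =
  inj₂ (shape q r , (s , s∈S , i , 3 , ≤-refl , shape≤E , keep , strict) , P7⇒InP (P7-shape q r))
  where
  keep : ∀ x → Untouched s i x → shape q r x ≡ E x
  keep x u = All.lookup same (∈-filter⁺ (¬? ∘ affected? 7 s i 3) (∈-allFin x) u)

  shape≤E : ∀ x → shape q r x ≤ E x
  shape≤E x with affected? 7 s i 3 x
  ... | yes a = All.lookup below (∈-filter⁺ (affected? 7 s i 3) (∈-allFin x) a)
  ... | no u  = ≤-reflexive (keep x u)

  strict : ∃ λ x → shape q r x < E x
  strict with ¬∀⟶∃¬ 7 _ (λ x → shape q r x ≟ E x) shape≉E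
  ... | x , ≢ = x , ≤∧≢⇒< (shape≤E x) ≢

1∈S12 : 1 ∈ S12
1∈S12 = here refl

2∈S12 : 2 ∈ S12
2∈S12 = there (here refl)

enters-via-empty₀ : ∀ {E} → E (# 0) ≡ 0 → E (# 5) ≤ E (# 2) → E (# 5) ≤ E (# 6) → EntersP E
enters-via-empty₀ {E} e0 5≤2 5≤6 = [ keep-2 , keep-6 ]′ (≤-total (E (# 2)) (E (# 6)))
  where
  keep-3-5 : E (# 3) + E (# 5) ≤ E (# 2) → E (# 3) + E (# 5) ≤ E (# 6) → EntersP E
  keep-3-5 ≤2 ≤6 = enter-shape (E (# 3)) (E (# 5)) 2∈S12 (# 2)
    (z≤n ∷ ≤2 ∷ z≤n ∷ ≤6 ∷ []) (sym e0 ∷ refl ∷ refl ∷ [])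

  keep-2 : E (# 2) ≤ E (# 6) → EntersP E
  keep-2 2≤6 with E (# 2) ≤? E (# 3) + E (# 5)
  ... | no 2≰ = keep-3-5 (<⇒≤ (≰⇒> 2≰)) (≤-trans (<⇒≤ (≰⇒> 2≰)) 2≤6)
  ... | yes 2≤ with ≤-offsetˡ 5≤2 2≤
  ...   | d , d≤3 , d+5≡2 = enter-shape d (E (# 5)) 2∈S12 (# 4)
    (z≤n ∷ d≤3 ∷ z≤n ∷ ≤-trans (≤-reflexive d+5≡2) 2≤6 ∷ []) (sym e0 ∷ d+5≡2 ∷ refl ∷ [])

  keep-6 : E (# 6) ≤ E (# 2) → EntersP E
  keep-6 6≤2 with E (# 6) ≤? E (# 3) + E (# 5)
  ... | no 6≰ = keep-3-5 (≤-trans (<⇒≤ (≰⇒> 6≰)) 6≤2) (<⇒≤ (≰⇒> 6≰))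
  ... | yes 6≤ with ≤-offsetˡ 5≤6 6≤
  ...   | d , d≤3 , d+5≡6 = enter-shape d (E (# 5)) 1∈S12 (# 1)
    (z≤n ∷ ≤-trans (≤-reflexive d+5≡6) 6≤2 ∷ d≤3 ∷ z≤n ∷ []) (sym e0 ∷ refl ∷ d+5≡6 ∷ [])

enters-via-empty₁ : ∀ {E} → E (# 1) ≡ 0 → E (# 3) ≤ E (# 2) → E (# 3) ≤ E (# 6) → EntersP E
enters-via-empty₁ {E} e1 3≤2 3≤6 = [ keep-2 , keep-6 ]′ (≤-total (E (# 2)) (E (# 6)))
  where
  keep-3-5 : E (# 3) + E (# 5) ≤ E (# 2) → E (# 3) + E (# 5) ≤ E (# 6) → EntersP E
  keep-3-5 ≤2 ≤6 = enter-shape (E (# 3)) (E (# 5)) 2∈S12 (# 0)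
    (z≤n ∷ ≤2 ∷ z≤n ∷ ≤6 ∷ []) (sym e1 ∷ refl ∷ refl ∷ [])

  keep-2 : E (# 2) ≤ E (# 6) → EntersP E
  keep-2 2≤6 with E (# 2) ≤? E (# 3) + E (# 5)
  ... | no 2≰ = keep-3-5 (<⇒≤ (≰⇒> 2≰)) (≤-trans (<⇒≤ (≰⇒> 2≰)) 2≤6)
  ... | yes 2≤ with ≤-offsetʳ 3≤2 2≤
  ...   | d , d≤5 , 3+d≡2 = enter-shape (E (# 3)) d 1∈S12 (# 4)
    (z≤n ∷ z≤n ∷ d≤5 ∷ ≤-trans (≤-reflexive 3+d≡2) 2≤6 ∷ []) (sym e1 ∷ 3+d≡2 ∷ refl ∷ [])

  keep-6 : E (# 6) ≤ E (# 2) → EntersP E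
  keep-6 6≤2 with E (# 6) ≤? E (# 3) + E (# 5)
  ... | no 6≰ = keep-3-5 (≤-trans (<⇒≤ (≰⇒> 6≰)) 6≤2) (<⇒≤ (≰⇒> 6≰))
  ... | yes 6≤ with ≤-offsetʳ 3≤6 6≤
  ...   | d , d≤5 , 3+d≡6 = enter-shape (E (# 3)) d 2∈S12 (# 5)
    (z≤n ∷ ≤-trans (≤-reflexive 3+d≡6) 6≤2 ∷ z≤n ∷ d≤5 ∷ []) (sym e1 ∷ refl ∷ 3+d≡6 ∷ [])

enters-via-empty₄ : ∀ {E} → E (# 4) ≡ 0 → (E (# 2) < E (# 6) → E (# 3) ≤ E (# 2)) →
                    (E (# 6) < E (# 2) → E (# 5) ≤ E (# 6)) → EntersP E
enters-via-empty₄ {E} e4 3≤2 5≤6 = by-order (<-cmp (E (# 2)) (E (# 6)))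
  where
  keep-3-5 : E (# 3) + E (# 5) ≤ E (# 2) → E (# 3) + E (# 5) ≤ E (# 6) → EntersP E
  keep-3-5 ≤2 ≤6 = enter-shape (E (# 3)) (E (# 5)) 1∈S12 (# 6)
    (z≤n ∷ z≤n ∷ ≤2 ∷ ≤6 ∷ []) (refl ∷ sym e4 ∷ refl ∷ [])

  by-order : Tri (E (# 2) < E (# 6)) (E (# 2) ≡ E (# 6)) (E (# 6) < E (# 2)) → EntersP E
  by-order (tri< 2<6 _ _) with E (# 2) ≤? E (# 3) + E (# 5)
  ... | no 2≰ = keep-3-5 (<⇒≤ (≰⇒> 2≰)) (≤-trans (<⇒≤ (≰⇒> 2≰)) (<⇒≤ 2<6))
  ... | yes 2≤ with ≤-offsetʳ (3≤2 2<6) 2≤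
  ...   | d , d≤5 , 3+d≡2 = enter-shape (E (# 3)) d 1∈S12 (# 5)
    (z≤n ∷ z≤n ∷ d≤5 ∷ ≤-trans (≤-reflexive 3+d≡2) (<⇒≤ 2<6) ∷ []) (3+d≡2 ∷ refl ∷ sym e4 ∷ [])
  by-order (tri> _ _ 6<2) with E (# 6) ≤? E (# 3) + E (# 5)
  ... | no 6≰ = keep-3-5 (≤-trans (<⇒≤ (≰⇒> 6≰)) (<⇒≤ 6<2)) (<⇒≤ (≰⇒> 6≰))
  ... | yes 6≤ with ≤-offsetˡ (5≤6 6<2) 6≤
  ...   | d , d≤3 , d+5≡6 = enter-shape d (E (# 5)) 1∈S12 (# 0)
    (z≤n ∷ z≤n ∷ ≤-trans (≤-reflexive d+5≡6) (<⇒≤ 6<2) ∷ d≤3 ∷ []) (sym e4 ∷ refl ∷ d+5≡6 ∷ [])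
  by-order (tri≈ _ 2≡6 _) with E (# 2) ≤? E (# 3) + E (# 5)
  ... | no 2≰ = keep-3-5 (<⇒≤ (≰⇒> 2≰)) (≤-trans (<⇒≤ (≰⇒> 2≰)) (≤-reflexive 2≡6))
  ... | yes 2≤ with ≤-split 2≤
  ...   | q , r , q≤3 , r≤5 , q+r≡2 = enter-shape q r 2∈S12 (# 1)
    (z≤n ∷ z≤n ∷ q≤3 ∷ r≤5 ∷ []) (q+r≡2 ∷ sym e4 ∷ trans q+r≡2 2≡6 ∷ [])

-- Rotating by 3 (resp. 6) brings pile 0 to place 4 (resp. 1).
enters-via-empty : ∀ {E} → E (# 0) ≡ 0 → EntersP E
enters-via-empty {E} e0 = by-order (<-cmp (E (# 5)) (E (# 2)))
  where
  via-4 : (E (# 5) < E (# 2) → E (# 6) ≤ E (# 5)) → (E (# 2) < E (# 5) → E (# 1) ≤ E (# 2)) →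
          EntersP E
  via-4 h₁ h₂ = absorbs-unrotate P7-resp (# 3) (enters-via-empty₄ e0 h₁ h₂)

  by-order : Tri (E (# 5) < E (# 2)) (E (# 5) ≡ E (# 2)) (E (# 2) < E (# 5)) → EntersP E
  by-order (tri≈ _ 5≡2 _) = via-4 (⊥-elim ∘ <-irrefl 5≡2) (⊥-elim ∘ <-irrefl (sym 5≡2))
  by-order (tri< 5<2 _ _) with E (# 6) ≤? E (# 5)
  ... | yes 6≤5 = via-4 (λ _ → 6≤5) (λ 2<5 → ⊥-elim (<-asym 5<2 2<5))
  ... | no 6≰5  = enters-via-empty₀ e0 (<⇒≤ 5<2) (<⇒≤ (≰⇒> 6≰5))
  by-order (tri> _ _ 2<5) with E (# 1) ≤? E (# 2)
  ... | yes 1≤2 = via-4 (λ 5<2 → ⊥-elim (<-asym 5<2 2<5)) (λ _ → 1≤2)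
  ... | no 1≰2  =
    absorbs-unrotate P7-resp (# 6) (enters-via-empty₁ e0 (<⇒≤ (≰⇒> 1≰2)) (<⇒≤ 2<5))

enters-from-minimum : ∀ N z → (∀ x → N z ≤ N x) → EntersP N
enters-from-minimum N z least = absorbs-unrotate P7-resp z
  (absorbs-resp P7-resp lift (absorbs-translate P7-resp P7-translate c (enters-via-empty (n∸n≡0 c))))
  where
  N₀ : Position 7
  N₀ = rotate 7 z N

  c : ℕ
  c = N₀ (# 0)

  lift : (λ x → c + (N₀ x ∸ c)) ≗ N₀
  lift x = m+[n∸m]≡n (subst (_≤ N₀ x) (cong N (sym (⊕-identityʳ z))) (least (z ⊕ toℕ x)))

P-absorbing : ∀ N → EntersP N
P-absorbing N = enters-from-minimum N (proj₁ (minimum N)) (proj₂ (minimum N))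

P-kernel : Kernel 7 S12 4 (CircIn 7 P7)
P-kernel = record
  { independent = λ {M} {M'} inP mv inP' →
                    P-independent (CircIn⇒InP {M} inP) mv (CircIn⇒InP {M'} inP')
  ; absorbing   = λ N → [ inj₁ ∘ InP⇒CircIn {N} ,
                          (λ (N' , mv , inP') → inj₂ (N' , mv , InP⇒CircIn {N'} inP')) ]′
                        (P-absorbing N)
  }

mainTheorem7 : (M : Position 7) → IsP 7 S12 4 M ⇔ CircIn 7 P7 M
mainTheorem7 = IsP⇔kernel P-kernel
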